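{- Let $G=(V,E)$ be a finite undirected graph. Consider the conjunctive Boolean network whose state-variables are indexed by $E\cup V$, with update functions $X_e(k+1)=X_e(k)$ for each edge $e\in E$ and $X_v(k+1)=\prod_{e\in E,\, v\in e} X_e(k)$ for each vertex $v\in V$ (the product of the variables of the edges incident to $v$). Let $\mathcal{I}\subseteq E\cup V$ be a set of minimum cardinality among all sets such that replacing the update function of $X_i$ by an independent Boolean control $U_i(k)$ (i.e. $X_i(k+1)=U_i(k)$) for every $i\in\mathcal{I}$ yields a controllable network. Then $Y:=\mathcal{I}\cap V$ is a minimum-cardinality dominating set of $G$.
   Context: Products of Boolean values denote AND, and an empty product equals $1$. A Boolean control network with state $X(k)\in\{0,1\}^m$ is controllable if for every pair of states $a,b\in\{0,1\}^m$ there exist an integer $N\ge 0$ and a control sequence steering the state from $X(0)=a$ to $X(N)=b$. A dominating set of $G$ is a subset $D\subseteq V$ such that every vertex in $V\setminus D$ has at least one neighbor in $D$. -}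

module Defs where

open import Data.Nat using (ℕ; _≤_)
open import Data.Fin using (Fin; _≟_)
open import Data.Bool using (Bool; true; false; if_then_else_; _∨_)
open import Data.Sum using (_⊎_; inj₁; inj₂)
open import Data.Product using (Σ; _×_; ∃; ∃-syntax)
open import Data.List using (List; []; _∷_; _++_; map; filterᵇ; allFin; length; foldl)
open import Data.Bool.ListAction using (and)
open import Relation.Nullary using (¬_)
open import Relation.Nullary.Decidable using (⌊_⌋)
open import Relation.Binary.PropositionalEquality using (_≡_; _≢_)

record Graph : Set where
  field
    n m       : ℕ
    end₁ end₂ : Fin m → Fin n
    loopless  : ∀ e → end₁ e ≢ end₂ e
    simple    : ∀ e e' →
                ((end₁ e ≡ end₁ e' × end₂ e ≡ end₂ e') ⊎ (end₁ e ≡ end₂ e' × end₂ e ≡ end₁ e'))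
                → e ≡ e'

module _ (G : Graph) where
  open Graph G

  Idx : Set
  Idx = Fin m ⊎ Fin n

  allIdx : List Idx
  allIdx = map inj₁ (allFin m) ++ map inj₂ (allFin n)

  State : Set
  State = Idx → Bool

  IdxSet : Set
  IdxSet = Idx → Bool

  cardIdx : IdxSet → ℕ
  cardIdx I = length (filterᵇ I allIdx)

  VSet : Set
  VSet = Fin n → Bool

  cardV : VSet → ℕ
  cardV D = length (filterᵇ D (allFin n))

  incident : Fin m → Fin n → Bool
  incident e v = ⌊ end₁ e ≟ v ⌋ ∨ ⌊ end₂ e ≟ v ⌋

  update : State → State
  update x (inj₁ e) = x (inj₁ e)
  update x (inj₂ v) = and (map (λ e → x (inj₁ e)) (filterᵇ (λ e → incident e v) (allFin m)))

  -- controlled network: X_i(k+1) = U_i(k) for i ∈ I (entries of u outside I are ignored)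
  Control : Set
  Control = Idx → Bool

  step : IdxSet → State → Control → State
  step I x u i = if I i then u i else update x i

  run : IdxSet → State → List Control → State
  run I = foldl (step I)

  Controllable : IdxSet → Set
  Controllable I = ∀ (a b : State) → ∃[ us ] (∀ i → run I a us i ≡ b i)

  MinimumControlSet : IdxSet → Set
  MinimumControlSet I = Controllable I × (∀ J → Controllable J → cardIdx I ≤ cardIdx J)

  Adjacent : Fin n → Fin n → Set
  Adjacent u v = ∃[ e ] ((end₁ e ≡ u × end₂ e ≡ v) ⊎ (end₁ e ≡ v × end₂ e ≡ u))

  Dominating : VSet → Set
  Dominating D = ∀ v → D v ≡ false → ∃[ u ] (D u ≡ true × Adjacent u v)

  MinimumDominating : VSet → Set
  MinimumDominating D = Dominating D × (∀ D' → Dominating D' → cardV D ≤ cardV D')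

  vertexPart : IdxSet → VSet
  vertexPart I v = I (inj₂ v)

module Submission where

-- Necessity.  An uncontrolled edge variable never changes, so a controllable
-- set I contains every edge.  If a vertex v is uncontrolled, steer the
-- all-true state to the state that is false exactly at v: in the last step
-- some edge e at v carries false; the other end w of e is then driven to
-- false unless it is controlled, while the target wants true at w.  Hence w
-- is a controlled neighbour of v, i.e. Y = I ∩ V is dominating.
--
-- Sufficiency.  For a dominating set D, controlling all edges and D steers
-- any state to any target in two steps: first load every edge with a signal
-- that makes each uncontrolled vertex compute its target value, then set
-- the controlled variables directly.
--
-- Finally |I| = |E| + |Y| for every set containing all edges, so minimality
-- of I among control sets transfers to minimality of Y among dominating sets.

open import Defs
open import Data.Nat using (ℕ; _+_; _≤_)
open import Data.Nat.Properties using (+-cancelˡ-≤; module ≤-Reasoning)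
open import Data.Fin using (Fin; _≟_)
open import Data.Bool using (Bool; true; false; not; _∨_; T?)
open import Data.Bool.Properties using (∧-zeroʳ; T-≡)
open import Data.Bool.ListAction using (and)
open import Data.Sum using (_⊎_; inj₁; inj₂)
open import Data.Product using (_×_; _,_; proj₂; ∃-syntax)
open import Data.List using (List; []; _∷_; _++_; map; filterᵇ; allFin; length)
open import Data.List.Properties using (filter-++; length-++; length-map; filter-all; length-tabulate)
open import Data.List.Relation.Unary.All using (universal)
open import Data.List.Relation.Unary.Any using (here; there)
open import Data.List.Membership.Propositional using (_∈_)
open import Data.List.Membership.Propositional.Properties using (∈-allFin; ∈-filter⁺; ∈-filter⁻)
open import Data.Empty using (⊥-elim)
open import Function using (_∘_; Equivalence)
open import Relation.Nullary using (yes; no)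
open import Relation.Nullary.Decidable using (⌊_⌋)
open import Relation.Binary.PropositionalEquality

module _ {A : Set} where

  filterᵇ-map : {B : Set} (p : B → Bool) (f : A → B) (xs : List A) →
                filterᵇ p (map f xs) ≡ map f (filterᵇ (p ∘ f) xs)
  filterᵇ-map p f [] = refl
  filterᵇ-map p f (x ∷ xs) with p (f x)
  ... | true  = cong (f x ∷_) (filterᵇ-map p f xs)
  ... | false = filterᵇ-map p f xs

  count-map : {B : Set} (p : B → Bool) (f : A → B) (xs : List A) →
              length (filterᵇ p (map f xs)) ≡ length (filterᵇ (p ∘ f) xs)
  count-map p f xs = trans (cong length (filterᵇ-map p f xs)) (length-map f (filterᵇ (p ∘ f) xs))

  count-++ : (p : A → Bool) (xs ys : List A) →
             length (filterᵇ p (xs ++ ys)) ≡ length (filterᵇ p xs) + length (filterᵇ p ys)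
  count-++ p xs ys = trans (cong length (filter-++ (T? ∘ p) xs ys)) (length-++ (filterᵇ p xs))

  and-map-true : (f : A → Bool) (xs : List A) →
                 (∀ {x} → x ∈ xs → f x ≡ true) → and (map f xs) ≡ true
  and-map-true f [] all-true = refl
  and-map-true f (x ∷ xs) all-true rewrite all-true (here refl) =
    and-map-true f xs (all-true ∘ there)

  and-map-false : (f : A → Bool) {x : A} (xs : List A) →
                  x ∈ xs → f x ≡ false → and (map f xs) ≡ false
  and-map-false f (y ∷ xs) (here refl) fx rewrite fx = refl
  and-map-false f (y ∷ xs) (there x∈xs) fx
    rewrite and-map-false f xs x∈xs fx = ∧-zeroʳ (f y)

  and-map-false⁻ : (f : A → Bool) (xs : List A) →
                   and (map f xs) ≡ false → ∃[ x ] (x ∈ xs × f x ≡ false)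
  and-map-false⁻ f (x ∷ xs) conj with f x in fx
  ... | false = x , here refl , fx
  ... | true with y , y∈xs , fy ← and-map-false⁻ f xs conj = y , there y∈xs , fy

module _ (G : Graph) where
  open Graph G

  incident⁻ : ∀ {e v} → incident G e v ≡ true → end₁ e ≡ v ⊎ end₂ e ≡ v
  incident⁻ {e} {v} inc with end₁ e ≟ v | end₂ e ≟ v
  ... | yes p | _     = inj₁ p
  ... | no _  | yes p = inj₂ p

  incident-end₁ : ∀ e → incident G e (end₁ e) ≡ true
  incident-end₁ e with end₁ e ≟ end₁ e
  ... | yes _ = refl
  ... | no ¬p = ⊥-elim (¬p refl)

  incident-end₂ : ∀ e → incident G e (end₂ e) ≡ true
  incident-end₂ e with end₁ e ≟ end₂ e | end₂ e ≟ end₂ e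
  ... | yes _ | _     = refl
  ... | no _  | yes _ = refl
  ... | no _  | no ¬p = ⊥-elim (¬p refl)

  joining-incident : ∀ {e u v} → (end₁ e ≡ u × end₂ e ≡ v) ⊎ (end₁ e ≡ v × end₂ e ≡ u) →
                     incident G e v ≡ true
  joining-incident {e} (inj₁ (_ , refl)) = incident-end₂ e
  joining-incident {e} (inj₂ (refl , _)) = incident-end₁ e

  other-end : ∀ {e v} → incident G e v ≡ true →
              ∃[ w ] (incident G e w ≡ true × w ≢ v × Adjacent G w v)
  other-end {e} inc with incident⁻ inc
  ... | inj₁ refl = end₂ e , incident-end₂ e , loopless e ∘ sym , e , inj₂ (refl , refl)
  ... | inj₂ refl = end₁ e , incident-end₁ e , loopless e , e , inj₁ (refl , refl)

  incidentEdges : Fin n → List (Fin m)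
  incidentEdges v = filterᵇ (λ e → incident G e v) (allFin m)

  ∈-incidentEdges : ∀ {e v} → incident G e v ≡ true → e ∈ incidentEdges v
  ∈-incidentEdges {e} inc = ∈-filter⁺ (T? ∘ λ e → incident G e _) (∈-allFin e) (Equivalence.from T-≡ inc)

  ∈-incidentEdges⁻ : ∀ {e v} → e ∈ incidentEdges v → incident G e v ≡ true
  ∈-incidentEdges⁻ {v = v} e∈ =
    Equivalence.to T-≡ (proj₂ (∈-filter⁻ (T? ∘ λ e → incident G e v) {xs = allFin m} e∈))

  vertex-update-true : (x : State G) (v : Fin n) →
                       (∀ e → incident G e v ≡ true → x (inj₁ e) ≡ true) → update G x (inj₂ v) ≡ true
  vertex-update-true x v all-true =
    and-map-true (x ∘ inj₁) (incidentEdges v) (λ e∈ → all-true _ (∈-incidentEdges⁻ e∈))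

  vertex-update-false : (x : State G) {e : Fin m} {v : Fin n} →
                        incident G e v ≡ true → x (inj₁ e) ≡ false → update G x (inj₂ v) ≡ false
  vertex-update-false x inc = and-map-false (x ∘ inj₁) _ (∈-incidentEdges inc)

  vertex-update-false⁻ : (x : State G) (v : Fin n) → update G x (inj₂ v) ≡ false →
                         ∃[ e ] (incident G e v ≡ true × x (inj₁ e) ≡ false)
  vertex-update-false⁻ x v upd with e , e∈ , xe ← and-map-false⁻ (x ∘ inj₁) (incidentEdges v) upd =
    e , ∈-incidentEdges⁻ e∈ , xe

  uncontrolled-step : (I : IdxSet G) (x : State G) (u : Control G) {i : Idx G} →
                      I i ≡ false → step G I x u i ≡ update G x i
  uncontrolled-step I x u uncontrolled rewrite uncontrolled = refl

  frozen-edge : (I : IdxSet G) {e : Fin m} → I (inj₁ e) ≡ false →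
                (a : State G) (us : List (Control G)) → run G I a us (inj₁ e) ≡ a (inj₁ e)
  frozen-edge I uncontrolled a [] = refl
  frozen-edge I uncontrolled a (u ∷ us)
    rewrite frozen-edge I uncontrolled (step G I a u) us | uncontrolled = refl

  controls-every-edge : (I : IdxSet G) → Controllable G I → ∀ e → I (inj₁ e) ≡ true
  controls-every-edge I controllable e with I (inj₁ e) in uncontrolled
  ... | true = refl
  ... | false with us , reach ← controllable (λ _ → false) (λ _ → true)
    with () ← trans (sym (reach (inj₁ e))) (frozen-edge I uncontrolled _ us)

  run-ends-with-step : (I : IdxSet G) (a : State G) (u : Control G) (us : List (Control G)) →
                       ∃[ x ] ∃[ u' ] (run G I a (u ∷ us) ≡ step G I x u')
  run-ends-with-step I a u []        = a , u , refl
  run-ends-with-step I a u (u' ∷ us) = run-ends-with-step I (step G I a u) u' us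

  reached-by-step : (I : IdxSet G) (a b : State G) (us : List (Control G)) →
                    (∀ i → run G I a us i ≡ b i) → (i₀ : Idx G) → a i₀ ≢ b i₀ →
                    ∃[ x ] ∃[ u ] (∀ i → step G I x u i ≡ b i)
  reached-by-step I a b [] reach i₀ differ = ⊥-elim (differ (reach i₀))
  reached-by-step I a b (u ∷ us) reach i₀ differ
    with x , u' , last ← run-ends-with-step I a u us =
    x , u' , λ i → trans (sym (cong-app last i)) (reach i)

  allButOne : Fin n → State G
  allButOne v (inj₁ e) = true
  allButOne v (inj₂ w) = not ⌊ w ≟ v ⌋

  allButOne-at : ∀ v → allButOne v (inj₂ v) ≡ false
  allButOne-at v with v ≟ v
  ... | yes _ = refl
  ... | no ¬p = ⊥-elim (¬p refl)

  true≢allButOne-at : ∀ v → true ≢ allButOne v (inj₂ v)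
  true≢allButOne-at v t≡target with () ← trans t≡target (allButOne-at v)

  allButOne-away : ∀ {v w} → w ≢ v → allButOne v (inj₂ w) ≡ true
  allButOne-away {v} {w} w≢v with w ≟ v
  ... | yes p = ⊥-elim (w≢v p)
  ... | no _  = refl

  -- If one step lands in allButOne v while the edge e carries false, then
  -- every other end w of e must be controlled, else it would become false.
  other-end-controlled : (I : IdxSet G) (x : State G) (u : Control G) {v w : Fin n} {e : Fin m} →
                         (∀ i → step G I x u i ≡ allButOne v i) →
                         incident G e w ≡ true → w ≢ v → x (inj₁ e) ≡ false → I (inj₂ w) ≡ true
  other-end-controlled I x u {w = w} lands inc w≢v xe with I (inj₂ w) in uncontrolled
  ... | true = refl
  ... | false with () ← trans (sym (trans (uncontrolled-step I x u uncontrolled) (vertex-update-false x inc xe)))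
                              (trans (lands (inj₂ w)) (allButOne-away w≢v))

  -- A last step into allButOne v, with v uncontrolled, reveals a controlled
  -- neighbour of v: the false at v comes from a false edge at v.
  dominated-by-last-step : (I : IdxSet G) (x : State G) (u : Control G) {v : Fin n} →
                           I (inj₂ v) ≡ false → (∀ i → step G I x u i ≡ allButOne v i) →
                           ∃[ w ] (I (inj₂ w) ≡ true × Adjacent G w v)
  dominated-by-last-step I x u {v} uncontrolled lands
    with e , inc , xe ← vertex-update-false⁻ x v
           (trans (sym (uncontrolled-step I x u uncontrolled)) (trans (lands (inj₂ v)) (allButOne-at v)))
    with w , inc-w , w≢v , adjacent ← other-end inc =
    w , other-end-controlled I x u lands inc-w w≢v xe , adjacent

  controlled-vertices-dominate : (I : IdxSet G) → Controllable G I → Dominating G (vertexPart G I)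
  controlled-vertices-dominate I controllable v uncontrolled
    with us , reach ← controllable (λ _ → true) (allButOne v)
    with x , u , lands ← reached-by-step I _ _ us reach (inj₂ v) (true≢allButOne-at v) =
    dominated-by-last-step I x u uncontrolled lands

  edgesPlus : VSet G → IdxSet G
  edgesPlus D (inj₁ _) = true
  edgesPlus D (inj₂ v) = D v

  -- The value loaded on an edge in the first step, given whether its ends
  -- are controlled (d₁, d₂) and their targets (b₁, b₂): an edge with exactly
  -- one uncontrolled end carries that end's target, other edges carry true.
  signal : (d₁ d₂ b₁ b₂ : Bool) → Bool
  signal false false _  _  = true
  signal false true  b₁ _  = b₁
  signal true  d₂    _  b₂ = d₂ ∨ b₂

  signal-true₁ : ∀ d₂ b₂ → signal false d₂ true b₂ ≡ true
  signal-true₁ false b₂ = refl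
  signal-true₁ true  b₂ = refl

  signal-true₂ : ∀ d₁ b₁ → signal d₁ false b₁ true ≡ true
  signal-true₂ false b₁ = refl
  signal-true₂ true  b₁ = refl

  edgeSignal : VSet G → State G → Fin m → Bool
  edgeSignal D b e = signal (D (end₁ e)) (D (end₂ e)) (b (inj₂ (end₁ e))) (b (inj₂ (end₂ e)))

  -- The first control loads the signals on the edges; its vertex entries are
  -- irrelevant, since the second control overwrites them.
  firstControl : VSet G → State G → Control G
  firstControl D b (inj₁ e) = edgeSignal D b e
  firstControl D b (inj₂ _) = true

  afterFirstStep : VSet G → State G → State G → State G
  afterFirstStep D a b = step G (edgesPlus D) a (firstControl D b)

  edgeSignal-true : (D : VSet G) (b : State G) {w : Fin n} → D w ≡ false → b (inj₂ w) ≡ true →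
                    ∀ e → incident G e w ≡ true → edgeSignal D b e ≡ true
  edgeSignal-true D b dw bw e inc with incident⁻ inc
  ... | inj₁ refl rewrite dw | bw = signal-true₁ (D (end₂ e)) (b (inj₂ (end₂ e)))
  ... | inj₂ refl rewrite dw | bw = signal-true₂ (D (end₁ e)) (b (inj₂ (end₁ e)))

  edgeSignal-false : (D : VSet G) (b : State G) {u w : Fin n} {e : Fin m} →
                     D u ≡ true → D w ≡ false → b (inj₂ w) ≡ false →
                     (end₁ e ≡ u × end₂ e ≡ w) ⊎ (end₁ e ≡ w × end₂ e ≡ u) → edgeSignal D b e ≡ false
  edgeSignal-false D b du dw bw (inj₁ (refl , refl)) rewrite du | dw | bw = refl
  edgeSignal-false D b du dw bw (inj₂ (refl , refl)) rewrite du | dw | bw = refl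

  -- After the first step each uncontrolled vertex computes its target; a
  -- false target is produced by the edge to a dominating neighbour.
  uncontrolled-reaches-target : (D : VSet G) → Dominating G D → (a b : State G) {w : Fin n} →
                                D w ≡ false → update G (afterFirstStep D a b) (inj₂ w) ≡ b (inj₂ w)
  uncontrolled-reaches-target D dominating a b {w} dw with b (inj₂ w) in bw
  ... | true = vertex-update-true (afterFirstStep D a b) w (edgeSignal-true D b dw bw)
  ... | false with u , du , e , joins ← dominating w dw =
    vertex-update-false (afterFirstStep D a b) (joining-incident joins) (edgeSignal-false D b du dw bw joins)

  two-step-steering : (D : VSet G) → Dominating G D → (a b : State G) →
                      ∀ i → run G (edgesPlus D) a (firstControl D b ∷ b ∷ []) i ≡ b i
  two-step-steering D dominating a b (inj₁ e) = refl
  two-step-steering D dominating a b (inj₂ w) with D w in dw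
  ... | true  = refl
  ... | false = uncontrolled-reaches-target D dominating a b dw

  edgesPlus-controllable : (D : VSet G) → Dominating G D → Controllable G (edgesPlus D)
  edgesPlus-controllable D dominating a b = firstControl D b ∷ b ∷ [] , two-step-steering D dominating a b

  edgeCount : IdxSet G → ℕ
  edgeCount K = length (filterᵇ (K ∘ inj₁) (allFin m))

  card-split : (K : IdxSet G) → cardIdx G K ≡ edgeCount K + cardV G (vertexPart G K)
  card-split K = trans (count-++ K (map inj₁ (allFin m)) (map inj₂ (allFin n)))
                       (cong₂ _+_ (count-map K inj₁ (allFin m)) (count-map K inj₂ (allFin n)))

  edgeCount-all : (K : IdxSet G) → (∀ e → K (inj₁ e) ≡ true) → edgeCount K ≡ m
  edgeCount-all K all-edges =
    trans (cong length (filter-all (T? ∘ K ∘ inj₁) (universal (Equivalence.from T-≡ ∘ all-edges) (allFin m))))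
          (length-tabulate (λ e → e))

  card-all-edges : (K : IdxSet G) → (∀ e → K (inj₁ e) ≡ true) → cardIdx G K ≡ m + cardV G (vertexPart G K)
  card-all-edges K all-edges = trans (card-split K) (cong (_+ cardV G (vertexPart G K)) (edgeCount-all K all-edges))

lemma2 : (G : Graph) (I : IdxSet G) → MinimumControlSet G I → MinimumDominating G (vertexPart G I)
lemma2 G I (controllable , minimal) =
  controlled-vertices-dominate G I controllable , fewest-vertices
  where
  open Graph G using (m)
  open ≤-Reasoning
  fewest-vertices : ∀ D → Dominating G D → cardV G (vertexPart G I) ≤ cardV G D
  fewest-vertices D dominating = +-cancelˡ-≤ m _ _ (begin
    m + cardV G (vertexPart G I)  ≡⟨ card-all-edges G I (controls-every-edge G I controllable) ⟨
    cardIdx G I                   ≤⟨ minimal (edgesPlus G D) (edgesPlus-controllable G D dominating) ⟩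
    cardIdx G (edgesPlus G D)     ≡⟨ card-all-edges G (edgesPlus G D) (λ _ → refl) ⟩
    m + cardV G D                 ∎)
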